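{- Let $M$ be a finitely generated abelian group, let $G$ and $H$ be finite digraphs, and let $f:E(G)\to E(H)$ be a mapping. (1) If $n(M)=\infty$, then $f$ is $M$-flow-continuous if and only if it is $\mathbb{Z}$-flow-continuous. (2) If $n(M)<\infty$, then $f$ is $M$-flow-continuous if and only if it is $\mathbb{Z}_{n(M)}$-flow-continuous.
   Context: Digraphs are finite multidigraphs; loops and parallel edges are allowed. For an abelian group $M$, a map $\varphi:E(G)\to M$ is an $M$-flow if at every vertex $v$ the sum of $\varphi$ over edges leaving $v$ equals the sum of $\varphi$ over edges entering $v$. A mapping $f:E(G)\to E(H)$ is $M$-flow-continuous if for every $M$-flow $\varphi$ on $H$ the composition $\varphi\circ f$ is an $M$-flow on $G$. Every finitely generated abelian group is isomorphic to $\mathbb{Z}^\alpha\times\prod_{i=1}^k\mathbb{Z}_{n_i}^{\beta_i}$. Set $n(M)=\infty$ if $\alpha>0$, and otherwise $n(M)=\operatorname{lcm}(n_1,\dots,n_k)$; equivalently, $n(M)$ is the largest order of an element of $M$. -}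

module Defs where

open import Level using (Level; _⊔_; 0ℓ)
open import Data.Nat as ℕ using (ℕ; zero; suc)
open import Data.Integer as ℤ using (ℤ; +_; -[1+_]; 0ℤ)
import Data.Integer.Properties as ℤP
open import Data.Integer.Solver using (module +-*-Solver)
open import Data.Fin as Fin using (Fin)
open import Data.Product using (Σ; ∃; _×_; _,_)
open import Data.Bool using (if_then_else_)
open import Relation.Nullary using (¬_; does)
open import Relation.Binary.PropositionalEquality
  using (_≡_; refl; sym; trans; cong; cong₂)
open import Algebra.Bundles using (AbelianGroup)
open import Algebra.Structures using (IsAbelianGroup)
open import Function.Bundles using (_⇔_)

-- Finite multidigraphs (loops and parallel edges allowed):
-- vertices Fin nV, edges Fin nE, each edge e goes from tail e to head e.

record Digraph : Set where
  field
    nV   : ℕ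
    nE   : ℕ
    tail : Fin nE → Fin nV
    head : Fin nE → Fin nV

open Digraph public

E : Digraph → Set
E G = Fin (nE G)

V : Digraph → Set
V G = Fin (nV G)

module _ {c ℓ : Level} (M : AbelianGroup c ℓ) where
  open AbelianGroup M

  sumFin : (k : ℕ) → (Fin k → Carrier) → Carrier
  sumFin zero    a = ε
  sumFin (suc k) a = a Fin.zero ∙ sumFin k (λ i → a (Fin.suc i))

  natMul : ℕ → Carrier → Carrier
  natMul zero    x = ε
  natMul (suc n) x = x ∙ natMul n x

  intMul : ℤ → Carrier → Carrier
  intMul (+ n)    x = natMul n x
  intMul -[1+ n ] x = (natMul (suc n) x) ⁻¹

  FinitelyGenerated : Set (c ⊔ ℓ)
  FinitelyGenerated =
    Σ ℕ λ k → Σ (Fin k → Carrier) λ g →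
      ∀ x → Σ (Fin k → ℤ) λ coeff → x ≈ sumFin k (λ i → intMul (coeff i) (g i))

  HasOrder : Carrier → ℕ → Set ℓ
  HasOrder x n =
    (0 ℕ.< n) × (natMul n x ≈ ε) × (∀ m → 0 ℕ.< m → m ℕ.< n → ¬ (natMul m x ≈ ε))

  InfiniteOrder : Carrier → Set ℓ
  InfiniteOrder x = ∀ m → 0 ℕ.< m → ¬ (natMul m x ≈ ε)

  -- n(M) = ∞  (n(M) is the largest order of an element of M)
  nIsInfinite : Set (c ⊔ ℓ)
  nIsInfinite = Σ Carrier InfiniteOrder

  nIs : ℕ → Set (c ⊔ ℓ)
  nIs n = (Σ Carrier λ x → HasOrder x n)
        × (∀ y → Σ ℕ λ m → HasOrder y m × m ℕ.≤ n)

  module _ (G : Digraph) where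
    outSum : (E G → Carrier) → V G → Carrier
    outSum φ v = sumFin (nE G) (λ e → if does (tail G e Fin.≟ v) then φ e else ε)

    inSum : (E G → Carrier) → V G → Carrier
    inSum φ v = sumFin (nE G) (λ e → if does (head G e Fin.≟ v) then φ e else ε)

    IsFlow : (E G → Carrier) → Set ℓ
    IsFlow φ = ∀ v → outSum φ v ≈ inSum φ v

  FlowContinuous : (G H : Digraph) → (E G → E H) → Set (c ⊔ ℓ)
  FlowContinuous G H f = ∀ (φ : E H → Carrier) → IsFlow H φ → IsFlow G (λ e → φ (f e))

ℤ-group : AbelianGroup 0ℓ 0ℓ
ℤ-group = ℤP.+-0-abelianGroup

-- ℤ_n realised as ℤ with equality "congruent modulo n"
-- x ≡ y (mod n)  iff  x - y = k * n  for some integer k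
record _≡[mod_]_ (x : ℤ) (n : ℕ) (y : ℤ) : Set where
  constructor _,_
  field
    quot : ℤ
    eq   : x ℤ.- y ≡ quot ℤ.* (+ n)

module _ (n : ℕ) where
  open +-*-Solver

  private
    _≈ₙ_ : ℤ → ℤ → Set
    x ≈ₙ y = x ≡[mod n ] y

    ≡⇒≈ : ∀ {x y} → x ≡ y → x ≈ₙ y
    ≡⇒≈ {x} refl = 0ℤ , trans (ℤP.+-inverseʳ x) (sym (ℤP.*-zeroˡ (+ n)))

    ≈-sym : ∀ {x y} → x ≈ₙ y → y ≈ₙ x
    ≈-sym {x} {y} (k , p) = ℤ.- k ,
      trans (solve 2 (λ x y → y :- x := :- (x :- y)) refl x y)
        (trans (cong ℤ.-_ p) (ℤP.neg-distribˡ-* k (+ n)))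

    ≈-trans : ∀ {x y z} → x ≈ₙ y → y ≈ₙ z → x ≈ₙ z
    ≈-trans {x} {y} {z} (k , p) (l , q) = k ℤ.+ l ,
      trans (solve 3 (λ x y z → x :- z := (x :- y) :+ (y :- z)) refl x y z)
        (trans (cong₂ ℤ._+_ p q) (sym (ℤP.*-distribʳ-+ (+ n) k l)))

    +-cong : ∀ {x y u v} → x ≈ₙ y → u ≈ₙ v → (x ℤ.+ u) ≈ₙ (y ℤ.+ v)
    +-cong {x} {y} {u} {v} (k , p) (l , q) = k ℤ.+ l ,
      trans (solve 4 (λ x y u v → (x :+ u) :- (y :+ v) := (x :- y) :+ (u :- v))
                refl x y u v)
        (trans (cong₂ ℤ._+_ p q) (sym (ℤP.*-distribʳ-+ (+ n) k l)))

    neg-cong : ∀ {x y} → x ≈ₙ y → (ℤ.- x) ≈ₙ (ℤ.- y)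
    neg-cong {x} {y} (k , p) = ℤ.- k ,
      trans (solve 2 (λ x y → (:- x) :- (:- y) := :- (x :- y)) refl x y)
        (trans (cong ℤ.-_ p) (ℤP.neg-distribˡ-* k (+ n)))

  ℤmod-isAbelianGroup : IsAbelianGroup _≈ₙ_ ℤ._+_ 0ℤ (λ x → ℤ.- x)
  ℤmod-isAbelianGroup = record
    { isGroup = record
      { isMonoid = record
        { isSemigroup = record
          { isMagma = record
            { isEquivalence = record
              { refl = ≡⇒≈ refl ; sym = ≈-sym ; trans = ≈-trans }
            ; ∙-cong = +-cong
            }
          ; assoc = λ x y z → ≡⇒≈ (ℤP.+-assoc x y z)
          }
        ; identity = (λ x → ≡⇒≈ (ℤP.+-identityˡ x)) , (λ x → ≡⇒≈ (ℤP.+-identityʳ x))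
        }
      ; inverse = (λ x → ≡⇒≈ (ℤP.+-inverseˡ x)) , (λ x → ≡⇒≈ (ℤP.+-inverseʳ x))
      ; ⁻¹-cong = neg-cong
      }
    ; comm = λ x y → ≡⇒≈ (ℤP.+-comm x y)
    }

  ℤ-mod : AbelianGroup 0ℓ 0ℓ
  ℤ-mod = record { isAbelianGroup = ℤmod-isAbelianGroup }

module Submission where

open import Defs
open import Level using (Level)
open import Data.Nat using (ℕ)
open import Data.Product using (_×_)
open import Algebra.Bundles using (AbelianGroup)
open import Function.Bundles using (_⇔_)

open import Algebra.Bundles.Raw using (RawMonoid)
open import Algebra.Morphism.Structures using (module MonoidMorphisms)
import Algebra.Properties.CommutativeMonoid.Sum
open import Data.Bool using (Bool; true; false; if_then_else_; not; _∧_; _∨_)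
open import Data.Bool.Properties using (∧-zeroʳ)
open import Data.Fin as Fin using (Fin)
open import Data.Integer as ℤ using (ℤ; +_; -[1+_]; 0ℤ; _⊖_)
import Data.Integer.Properties as ℤP
open import Data.Integer.Solver using (module +-*-Solver)
open import Data.Nat as ℕ using (zero; suc; NonZero; NonTrivial)
import Data.Nat.Properties as ℕP
open import Data.Nat.Coprimality as Coprime using (Coprime; coprime⇒gcd≡1; gcd≡1⇒coprime; coprime-divisor)
open import Data.Nat.Divisibility
  using (_∣_; divides; quotient; m∣n⇒n≡m*quotient; m∣n⇒n≡quotient*m; 0∣⇒≡0; quotient-∣; quotient-<; quotient≢0;
         ∣⇒≤; ∣-refl; ∣-trans; *-pres-∣; m%n≡0⇒n∣m; n∣m*n; m∣m*n; *-cancelʳ-∣)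
open import Data.Nat.DivMod using (_%_; _/_; m≡m%n+[m/n]*n; m%n<n)
open import Data.Nat.GCD using (gcd; gcd[m,n]∣m; gcd[m,n]∣n; gcd-greatest; gcd[m,n]≡0⇒n≡0)
open import Data.Nat.Induction using (<-rec)
open import Data.Nat.LCM using (lcm; lcm-least; gcd*lcm)
open import Data.Product using (Σ; _,_; proj₁; proj₂)
open import Data.Vec.Functional using (_∷_)
open import Function.Base using (_∘_)
open import Function.Bundles using (mk⇔; Equivalence)
open import Relation.Binary.PropositionalEquality as ≡ using (_≡_; ≢-sym)
open import Relation.Nullary using (Dec; does; yes; no; contradiction)
open import Relation.Nullary.Decidable using (dec-true; dec-false)

-- Every M-flow on a finite digraph is a finite sum of terms z·m with z an integer flow and
-- m ∈ M: induct on the edges; the first edge either lies on an integer cycle, which is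
-- subtracted, or is the only edge crossing some vertex cut, which forces its value to vanish.
-- Hence ℤ-flow-continuity implies M-flow-continuity, and so does ℤₙ-flow-continuity when
-- n·M = 0, which holds for n = n(M) because every order divides the maximal one.
-- Conversely k ↦ k·x embeds ℤ into M for x of infinite order, and ℤₙ for x of order n, and
-- flow-continuity descends along injective homomorphisms.

module VertexSums {c ℓ} (M : AbelianGroup c ℓ) where
  open AbelianGroup M
  open import Algebra.Properties.CommutativeMonoid.Sum commutativeMonoid
  open import Algebra.Properties.Group group using (∙-cancelʳ)
  open import Relation.Binary.Reasoning.Setoid setoid

  sumFin≡sum : ∀ k (a : Fin k → Carrier) → sumFin M k a ≡ sum a
  sumFin≡sum zero    a = ≡.refl
  sumFin≡sum (suc k) a = ≡.cong (a Fin.zero ∙_) (sumFin≡sum k (λ i → a (Fin.suc i)))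

  keepIf : Bool → Carrier → Carrier
  keepIf b x = if b then x else ε

  keepIf-cong : ∀ b {x y} → x ≈ y → keepIf b x ≈ keepIf b y
  keepIf-cong true  x≈y = x≈y
  keepIf-cong false x≈y = refl

  keepIf-∙ : ∀ b x y → keepIf b (x ∙ y) ≈ keepIf b x ∙ keepIf b y
  keepIf-∙ true  x y = refl
  keepIf-∙ false x y = sym (identityˡ ε)

  keepIf-ε : ∀ b → keepIf b ε ≈ ε
  keepIf-ε true  = refl
  keepIf-ε false = refl

  keepIf-comm : ∀ b d x → keepIf b (keepIf d x) ≈ keepIf d (keepIf b x)
  keepIf-comm true  d     x = refl
  keepIf-comm false true  x = refl
  keepIf-comm false false x = refl

  keepIf-sum : ∀ b {k} (a : Fin k → Carrier) → keepIf b (sum a) ≈ ∑[ i < k ] keepIf b (a i)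
  keepIf-sum true  a = refl
  keepIf-sum false {k} a = sym (sum-replicate-zero k)

  sum-keepIf-≟ : ∀ {n} (x : Fin n) (a : Fin n → Carrier) →
                 ∑[ v < n ] keepIf (does (x Fin.≟ v)) (a v) ≈ a x
  sum-keepIf-≟ {suc n} Fin.zero    a = trans (∙-congˡ (sum-replicate-zero n)) (identityʳ _)
  sum-keepIf-≟         (Fin.suc x) a = trans (identityˡ _) (sum-keepIf-≟ x (λ v → a (Fin.suc v)))

  incidentAt : ∀ {n k} → (Fin k → Fin n) → Fin n → (Fin k → Carrier) → Fin k → Carrier
  incidentAt t v φ e = keepIf (does (t e Fin.≟ v)) (φ e)

  sumAt : ∀ {n k} → (Fin k → Fin n) → (Fin k → Carrier) → Fin n → Carrier
  sumAt t φ v = sum (incidentAt t v φ)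

  record Balanced {n k} (t h : Fin k → Fin n) (φ : Fin k → Carrier) : Set ℓ where
    constructor balanced
    field conserved : ∀ v → sumAt t φ v ≈ sumAt h φ v

  open Balanced public

  isFlow⇔balanced : ∀ K φ → IsFlow M K φ ⇔ Balanced (tail K) (head K) φ
  isFlow⇔balanced K φ = mk⇔
    (λ flow → balanced λ v → begin
      sumAt (tail K) φ v ≡⟨ sumFin≡sum (nE K) _ ⟨
      outSum M K φ v     ≈⟨ flow v ⟩
      inSum M K φ v      ≡⟨ sumFin≡sum (nE K) _ ⟩
      sumAt (head K) φ v ∎)
    (λ bal v → begin
      outSum M K φ v     ≡⟨ sumFin≡sum (nE K) _ ⟩
      sumAt (tail K) φ v ≈⟨ conserved bal v ⟩
      sumAt (head K) φ v ≡⟨ sumFin≡sum (nE K) _ ⟨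
      inSum M K φ v      ∎)

  module _ {n k} (t : Fin k → Fin n) where

    sumAt-cong : ∀ {φ ψ} → (∀ e → φ e ≈ ψ e) → ∀ v → sumAt t φ v ≈ sumAt t ψ v
    sumAt-cong φ≈ψ v = sum-cong-≋ (λ e → keepIf-cong (does (t e Fin.≟ v)) (φ≈ψ e))

    sumAt-∙ : ∀ φ ψ v → sumAt t (λ e → φ e ∙ ψ e) v ≈ sumAt t φ v ∙ sumAt t ψ v
    sumAt-∙ φ ψ v = trans (sum-cong-≋ (λ e → keepIf-∙ (does (t e Fin.≟ v)) (φ e) (ψ e)))
                          (∑-distrib-+ (incidentAt t v φ) (incidentAt t v ψ))

    sumAt-sum : ∀ {r} (a : Fin r → Fin k → Carrier) v →
                sumAt t (λ e → ∑[ i < r ] a i e) v ≈ ∑[ i < r ] sumAt t (a i) v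
    sumAt-sum a v = trans (sum-cong-≋ (λ e → keepIf-sum (does (t e Fin.≟ v)) (λ i → a i e)))
                          (∑-comm (λ e i → keepIf (does (t e Fin.≟ v)) (a i e)))

    sum-sumAt : ∀ (S : Fin n → Bool) φ →
                ∑[ v < n ] keepIf (S v) (sumAt t φ v) ≈ ∑[ e < k ] keepIf (S (t e)) (φ e)
    sum-sumAt S φ = begin
      ∑[ v < n ] keepIf (S v) (sumAt t φ v)
        ≈⟨ sum-cong-≋ (λ v → keepIf-sum (S v) (λ e → keepIf (does (t e Fin.≟ v)) (φ e))) ⟩
      ∑[ v < n ] ∑[ e < k ] keepIf (S v) (keepIf (does (t e Fin.≟ v)) (φ e))
        ≈⟨ ∑-comm (λ v e → keepIf (S v) (keepIf (does (t e Fin.≟ v)) (φ e))) ⟩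
      ∑[ e < k ] ∑[ v < n ] keepIf (S v) (keepIf (does (t e Fin.≟ v)) (φ e))
        ≈⟨ sum-cong-≋ (λ e → sum-cong-≋ (λ v → keepIf-comm (S v) _ (φ e))) ⟩
      ∑[ e < k ] ∑[ v < n ] keepIf (does (t e Fin.≟ v)) (keepIf (S v) (φ e))
        ≈⟨ sum-cong-≋ (λ e → sum-keepIf-≟ (t e) (λ v → keepIf (S v) (φ e))) ⟩
      ∑[ e < k ] keepIf (S (t e)) (φ e) ∎

  module _ {n k} {t h : Fin k → Fin n} where

    balanced-cong : ∀ {φ ψ} → (∀ e → φ e ≈ ψ e) → Balanced t h φ → Balanced t h ψ
    balanced-cong φ≈ψ bal = balanced λ v →
      trans (sym (sumAt-cong t φ≈ψ v)) (trans (conserved bal v) (sumAt-cong h φ≈ψ v))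

    balanced-∙ : ∀ {φ ψ} → Balanced t h φ → Balanced t h ψ → Balanced t h (λ e → φ e ∙ ψ e)
    balanced-∙ {φ} {ψ} bal₁ bal₂ = balanced λ v →
      trans (sumAt-∙ t φ ψ v) (trans (∙-cong (conserved bal₁ v) (conserved bal₂ v)) (sym (sumAt-∙ h φ ψ v)))

    balanced-sum : ∀ {r} {a : Fin r → Fin k → Carrier} → (∀ i → Balanced t h (a i)) →
                   Balanced t h (λ e → ∑[ i < r ] a i e)
    balanced-sum {a = a} bal = balanced λ v →
      trans (sumAt-sum t a v) (trans (sum-cong-≋ (λ i → conserved (bal i) v)) (sym (sumAt-sum h a v)))

    balanced-cut : ∀ {φ} → Balanced t h φ → ∀ S →
                   ∑[ e < k ] keepIf (S (t e)) (φ e) ≈ ∑[ e < k ] keepIf (S (h e)) (φ e)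
    balanced-cut {φ} bal S = begin
      ∑[ e < k ] keepIf (S (t e)) (φ e)       ≈⟨ sum-sumAt t S φ ⟨
      ∑[ v < n ] keepIf (S v) (sumAt t φ v)   ≈⟨ sum-cong-≋ (λ v → keepIf-cong (S v) (conserved bal v)) ⟩
      ∑[ v < n ] keepIf (S v) (sumAt h φ v)   ≈⟨ sum-sumAt h S φ ⟩
      ∑[ e < k ] keepIf (S (h e)) (φ e)       ∎

  sumAt-drop : ∀ {n k} (t : Fin (suc k) → Fin n) {φ} → φ Fin.zero ≈ ε → ∀ v →
               sumAt t φ v ≈ sumAt (t ∘ Fin.suc) (φ ∘ Fin.suc) v
  sumAt-drop t φ₀≈ε v =
    trans (∙-congʳ (trans (keepIf-cong (does (t Fin.zero Fin.≟ v)) φ₀≈ε) (keepIf-ε _))) (identityˡ _)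

  module _ {n k} {t h : Fin (suc k) → Fin n} where

    balanced-drop : ∀ {φ} → φ Fin.zero ≈ ε → Balanced t h φ →
                    Balanced (t ∘ Fin.suc) (h ∘ Fin.suc) (φ ∘ Fin.suc)
    balanced-drop {φ} φ₀≈ε bal = balanced λ v →
      trans (sym (sumAt-drop t {φ} φ₀≈ε v)) (trans (conserved bal v) (sumAt-drop h {φ} φ₀≈ε v))

    balanced-ε∷ : ∀ {φ} → Balanced (t ∘ Fin.suc) (h ∘ Fin.suc) φ → Balanced t h (ε ∷ φ)
    balanced-ε∷ {φ} bal = balanced λ v →
      trans (sumAt-drop t {ε ∷ φ} refl v) (trans (conserved bal v) (sym (sumAt-drop h {ε ∷ φ} refl v)))

    balanced-bridge : ∀ {φ} → Balanced t h φ → ∀ {S} → (∀ e → S (t (Fin.suc e)) ≡ S (h (Fin.suc e))) →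
                      S (t Fin.zero) ≡ false → S (h Fin.zero) ≡ true → φ Fin.zero ≈ ε
    balanced-bridge {φ} bal {S} closed tail∉S head∈S = sym (∙-cancelʳ rest ε (φ Fin.zero) (begin
      ε ∙ rest                               ≡⟨ ≡.cong (λ b → keepIf b (φ Fin.zero) ∙ rest) tail∉S ⟨
      ∑[ e < suc k ] keepIf (S (t e)) (φ e)  ≈⟨ balanced-cut bal S ⟩
      ∑[ e < suc k ] keepIf (S (h e)) (φ e)
        ≡⟨ ≡.cong₂ (λ b r → keepIf b (φ Fin.zero) ∙ r) head∈S
             (sum-cong-≗ (λ e → ≡.cong (λ b → keepIf b (φ (Fin.suc e))) (≡.sym (closed e)))) ⟩
      φ Fin.zero ∙ rest                      ∎))
      where
      rest = ∑[ e < k ] keepIf (S (t (Fin.suc e))) (φ (Fin.suc e))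

module FlowMaps {a b ℓa ℓb} (A : AbelianGroup a ℓa) (B : AbelianGroup b ℓb) where
  private
    module A = AbelianGroup A
    module B = AbelianGroup B
    module ΣA = VertexSums A
    module ΣB = VertexSums B
    module ∑A = Algebra.Properties.CommutativeMonoid.Sum A.commutativeMonoid
    module ∑B = Algebra.Properties.CommutativeMonoid.Sum B.commutativeMonoid
  open MonoidMorphisms A.rawMonoid B.rawMonoid
  open B using (_≈_; refl; sym; trans)

  module _ {⟦_⟧ : A.Carrier → B.Carrier} (isHom : IsMonoidHomomorphism ⟦_⟧) where
    open IsMonoidHomomorphism isHom

    sum-homo : ∀ {k} (x : Fin k → A.Carrier) → ∑B.sum (λ e → ⟦ x e ⟧) ≈ ⟦ ∑A.sum x ⟧
    sum-homo {zero}  x = sym ε-homo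
    sum-homo {suc k} x = trans (B.∙-congˡ (sum-homo (λ e → x (Fin.suc e)))) (sym (homo _ _))

    keepIf-homo : ∀ d x → ΣB.keepIf d ⟦ x ⟧ ≈ ⟦ ΣA.keepIf d x ⟧
    keepIf-homo true  x = refl
    keepIf-homo false x = sym ε-homo

    sumAt-homo : ∀ {n k} (t : Fin k → Fin n) φ v → ΣB.sumAt t (λ e → ⟦ φ e ⟧) v ≈ ⟦ ΣA.sumAt t φ v ⟧
    sumAt-homo t φ v =
      trans (∑B.sum-cong-≋ (λ e → keepIf-homo (does (t e Fin.≟ v)) (φ e))) (sum-homo (ΣA.incidentAt t v φ))

    balanced-map : ∀ {n k} {t h : Fin k → Fin n} {φ} → ΣA.Balanced t h φ → ΣB.Balanced t h (λ e → ⟦ φ e ⟧)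
    balanced-map {t = t} {h} {φ} bal = ΣB.balanced λ v →
      trans (sumAt-homo t φ v) (trans (⟦⟧-cong (ΣA.conserved bal v)) (sym (sumAt-homo h φ v)))

    isFlow-map : ∀ {K φ} → IsFlow A K φ → IsFlow B K (λ e → ⟦ φ e ⟧)
    isFlow-map {K} {φ} flow =
      Equivalence.from (ΣB.isFlow⇔balanced K _) (balanced-map (Equivalence.to (ΣA.isFlow⇔balanced K φ) flow))

  module _ {⟦_⟧ : A.Carrier → B.Carrier} (isMono : IsMonoidMonomorphism ⟦_⟧) where
    open IsMonoidMonomorphism isMono

    isFlow-reflect : ∀ {K φ} → IsFlow B K (λ e → ⟦ φ e ⟧) → IsFlow A K φ
    isFlow-reflect {K} {φ} flow = Equivalence.from (ΣA.isFlow⇔balanced K φ) (ΣA.balanced λ v → injective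
      (trans (sym (sumAt-homo isMonoidHomomorphism (tail K) φ v))
        (trans (ΣB.conserved (Equivalence.to (ΣB.isFlow⇔balanced K _) flow) v)
          (sumAt-homo isMonoidHomomorphism (head K) φ v))))

    flowContinuous-reflect : ∀ {G H f} → FlowContinuous B G H f → FlowContinuous A G H f
    flowContinuous-reflect {G} {H} {f} continuous φ flow =
      isFlow-reflect {G} (continuous (λ e → ⟦ φ e ⟧) (isFlow-map isMonoidHomomorphism {H} flow))

module Multiples {c ℓ} (M : AbelianGroup c ℓ) where
  open AbelianGroup M
  open import Algebra.Properties.AbelianGroup M
  open import Algebra.Properties.CommutativeSemigroup commutativeSemigroup using (interchange)
  open import Algebra.Properties.Monoid.Mult monoid using (×-congʳ; ×-homo-+; ×-assocˡ) renaming (_×_ to _·_)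
  open import Algebra.Properties.CommutativeMonoid.Mult commutativeMonoid using (×-distrib-+)
  open import Algebra.Properties.CommutativeMonoid.Sum commutativeMonoid using (sum-replicate; sum-replicate-zero)
  open import Relation.Binary.Reasoning.Setoid setoid

  natMul≡× : ∀ n x → natMul M n x ≡ n · x
  natMul≡× zero    x = ≡.refl
  natMul≡× (suc n) x = ≡.cong (x ∙_) (natMul≡× n x)

  natMul-cong : ∀ n {x y} → x ≈ y → natMul M n x ≈ natMul M n y
  natMul-cong n {x} {y} x≈y rewrite natMul≡× n x | natMul≡× n y = ×-congʳ n x≈y

  natMul-+ : ∀ m n x → natMul M (m ℕ.+ n) x ≈ natMul M m x ∙ natMul M n x
  natMul-+ m n x rewrite natMul≡× (m ℕ.+ n) x | natMul≡× m x | natMul≡× n x = ×-homo-+ x m n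

  natMul-* : ∀ m n x → natMul M (m ℕ.* n) x ≈ natMul M m (natMul M n x)
  natMul-* m n x rewrite natMul≡× (m ℕ.* n) x | natMul≡× n x | natMul≡× m (n · x) = sym (×-assocˡ x m n)

  natMul-∙ : ∀ n x y → natMul M n (x ∙ y) ≈ natMul M n x ∙ natMul M n y
  natMul-∙ n x y rewrite natMul≡× n (x ∙ y) | natMul≡× n x | natMul≡× n y = ×-distrib-+ x y n

  natMul-ε : ∀ n → natMul M n ε ≈ ε
  natMul-ε n rewrite natMul≡× n ε = trans (sym (sum-replicate n)) (sum-replicate-zero n)

  natMul-multiple≈ε : ∀ {o j} z → natMul M o z ≈ ε → o ∣ j → natMul M j z ≈ ε
  natMul-multiple≈ε {o} z oz≈ε (divides q ≡.refl) =
    trans (natMul-* q o z) (trans (natMul-cong q oz≈ε) (natMul-ε q))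

  x∙y∙[x∙z]⁻¹≈y∙z⁻¹ : ∀ x y z → x ∙ y ∙ (x ∙ z) ⁻¹ ≈ y ∙ z ⁻¹
  x∙y∙[x∙z]⁻¹≈y∙z⁻¹ x y z = begin
    x ∙ y ∙ (x ∙ z) ⁻¹      ≈⟨ ∙-congˡ (⁻¹-∙-comm x z) ⟨
    x ∙ y ∙ (x ⁻¹ ∙ z ⁻¹)   ≈⟨ interchange x y (x ⁻¹) (z ⁻¹) ⟩
    x ∙ x ⁻¹ ∙ (y ∙ z ⁻¹)   ≈⟨ ∙-congʳ (inverseʳ x) ⟩
    ε ∙ (y ∙ z ⁻¹)          ≈⟨ identityˡ _ ⟩
    y ∙ z ⁻¹                ∎

  intMul-⊖ : ∀ p q x → intMul M (p ⊖ q) x ≈ natMul M p x ∙ natMul M q x ⁻¹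
  intMul-⊖ p       zero    x = sym (trans (∙-congˡ ε⁻¹≈ε) (identityʳ _))
  intMul-⊖ zero    (suc q) x = sym (identityˡ _)
  intMul-⊖ (suc p) (suc q) x rewrite ℤP.[1+m]⊖[1+n]≡m⊖n p q =
    trans (intMul-⊖ p q x) (sym (x∙y∙[x∙z]⁻¹≈y∙z⁻¹ x _ _))

  intMul-+ : ∀ a b x → intMul M (a ℤ.+ b) x ≈ intMul M a x ∙ intMul M b x
  intMul-+ (+ p)    (+ q)    x = natMul-+ p q x
  intMul-+ (+ p)    -[1+ q ] x = intMul-⊖ p (suc q) x
  intMul-+ -[1+ p ] (+ q)    x = trans (intMul-⊖ q (suc p) x) (comm _ _)
  intMul-+ -[1+ p ] -[1+ q ] x = begin
    natMul M (suc (suc (p ℕ.+ q))) x ⁻¹                  ≡⟨ ≡.cong (λ n → natMul M (suc n) x ⁻¹) (ℕP.+-suc p q) ⟨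
    natMul M (suc p ℕ.+ suc q) x ⁻¹                      ≈⟨ ⁻¹-cong (natMul-+ (suc p) (suc q) x) ⟩
    (natMul M (suc p) x ∙ natMul M (suc q) x) ⁻¹         ≈⟨ ⁻¹-∙-comm _ _ ⟨
    natMul M (suc p) x ⁻¹ ∙ natMul M (suc q) x ⁻¹        ∎

  intMul-neg : ∀ a x → intMul M (ℤ.- a) x ≈ intMul M a x ⁻¹
  intMul-neg (+ zero)  x = sym ε⁻¹≈ε
  intMul-neg (+ suc p) x = refl
  intMul-neg -[1+ p ]  x = sym (⁻¹-involutive _)

  intMul-multiple≈ε : ∀ a {n x} → natMul M n x ≈ ε → intMul M (a ℤ.* + n) x ≈ ε
  intMul-multiple≈ε (+ p) {n} {x} nx≈ε rewrite ≡.sym (ℤP.pos-* p n) = natMul-multiple≈ε {n} x nx≈ε (n∣m*n p)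
  intMul-multiple≈ε -[1+ p ] {n} {x} nx≈ε = begin
    intMul M (-[1+ p ] ℤ.* + n) x      ≡⟨ ≡.cong (λ a → intMul M a x) (ℤP.neg-distribˡ-* (+ suc p) (+ n)) ⟨
    intMul M (ℤ.- (+ suc p ℤ.* + n)) x ≈⟨ intMul-neg (+ suc p ℤ.* + n) x ⟩
    intMul M (+ suc p ℤ.* + n) x ⁻¹    ≈⟨ ⁻¹-cong (intMul-multiple≈ε (+ suc p) {n} {x} nx≈ε) ⟩
    ε ⁻¹                               ≈⟨ ε⁻¹≈ε ⟩
    ε                                  ∎

  intMul-minus : ∀ a b x → intMul M (a ℤ.- b) x ≈ intMul M a x ∙ intMul M b x ⁻¹
  intMul-minus a b x = trans (intMul-+ a (ℤ.- b) x) (∙-congˡ (intMul-neg b x))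

coprime⇒*∣ : ∀ {m n j} → Coprime m n → m ∣ j → n ∣ j → m ℕ.* n ∣ j
coprime⇒*∣ {m} {n} coprime m∣j n∣j = ≡.subst (_∣ _) lcm≡* (lcm-least m∣j n∣j)
  where
  lcm≡* : lcm m n ≡ m ℕ.* n
  lcm≡* = ≡.trans (≡.sym (ℕP.*-identityˡ _))
            (≡.trans (≡.cong (ℕ._* lcm m n) (≡.sym (coprime⇒gcd≡1 coprime))) (gcd*lcm m n))

module Orders {c ℓ} (M : AbelianGroup c ℓ) where
  open AbelianGroup M
  open Multiples M
  open import Relation.Binary.Reasoning.Setoid setoid

  IsOrder : Carrier → ℕ → Set ℓ
  IsOrder z o = natMul M o z ≈ ε × (∀ j → natMul M j z ≈ ε → o ∣ j)

  hasOrder⇒isOrder : ∀ {z o} → HasOrder M z o → IsOrder z o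
  hasOrder⇒isOrder {z} {o} (o>0 , oz≈ε , minimal) = oz≈ε , o∣
    where
    instance
      o≢0 : NonZero o
      o≢0 = ℕ.>-nonZero o>0
    o∣ : ∀ j → natMul M j z ≈ ε → o ∣ j
    o∣ j jz≈ε with j % o ℕ.≟ 0
    ... | yes r≡0 = m%n≡0⇒n∣m j o r≡0
    ... | no  r≢0 = contradiction rz≈ε (minimal (j % o) (ℕP.n≢0⇒n>0 r≢0) (m%n<n j o))
      where
      rz≈ε : natMul M (j % o) z ≈ ε
      rz≈ε = begin
        natMul M (j % o) z                                   ≈⟨ identityʳ _ ⟨
        natMul M (j % o) z ∙ ε                               ≈⟨ ∙-congˡ (natMul-multiple≈ε {o} z oz≈ε (n∣m*n (j / o))) ⟨
        natMul M (j % o) z ∙ natMul M ((j / o) ℕ.* o) z      ≈⟨ natMul-+ (j % o) _ z ⟨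
        natMul M (j % o ℕ.+ (j / o) ℕ.* o) z                 ≡⟨ ≡.cong (λ i → natMul M i z) (m≡m%n+[m/n]*n j o) ⟨
        natMul M j z                                         ≈⟨ jz≈ε ⟩
        ε                                                    ∎

  isOrder-multiple : ∀ {z a} b .{{_ : NonZero b}} → IsOrder z (b ℕ.* a) → IsOrder (natMul M b z) a
  isOrder-multiple {z} {a} b (baz≈ε , ba∣) = a·bz≈ε , a∣
    where
    a·bz≈ε : natMul M a (natMul M b z) ≈ ε
    a·bz≈ε = trans (sym (natMul-* a b z))
               (trans (reflexive (≡.cong (λ i → natMul M i z) (ℕP.*-comm a b))) baz≈ε)
    a∣ : ∀ j → natMul M j (natMul M b z) ≈ ε → a ∣ j
    a∣ j jbz≈ε =
      *-cancelʳ-∣ b (≡.subst (_∣ j ℕ.* b) (ℕP.*-comm b a) (ba∣ (j ℕ.* b) (trans (natMul-* j b z) jbz≈ε)))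

  -- From j (z₁ ∙ z₂) = ε, multiplying by o₂ kills z₂ and leaves o₂ j z₁ = ε.
  isOrder-∙-∣ : ∀ {z₁ z₂ o₁ o₂} → Coprime o₁ o₂ → IsOrder z₁ o₁ → natMul M o₂ z₂ ≈ ε →
                ∀ j → natMul M j (z₁ ∙ z₂) ≈ ε → o₁ ∣ j
  isOrder-∙-∣ {z₁} {z₂} {o₁} {o₂} coprime (_ , o₁∣) o₂z₂≈ε j jz≈ε =
    coprime-divisor coprime (o₁∣ (o₂ ℕ.* j) (begin
      natMul M (o₂ ℕ.* j) z₁                            ≈⟨ identityʳ _ ⟨
      natMul M (o₂ ℕ.* j) z₁ ∙ ε                        ≈⟨ ∙-congˡ (natMul-multiple≈ε {o₂} z₂ o₂z₂≈ε (m∣m*n j)) ⟨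
      natMul M (o₂ ℕ.* j) z₁ ∙ natMul M (o₂ ℕ.* j) z₂   ≈⟨ natMul-∙ (o₂ ℕ.* j) z₁ z₂ ⟨
      natMul M (o₂ ℕ.* j) (z₁ ∙ z₂)                     ≈⟨ natMul-multiple≈ε {j} (z₁ ∙ z₂) jz≈ε (n∣m*n o₂) ⟩
      ε                                                 ∎))

  isOrder-∙ : ∀ {z₁ z₂ o₁ o₂} → Coprime o₁ o₂ → IsOrder z₁ o₁ → IsOrder z₂ o₂ →
              IsOrder (z₁ ∙ z₂) (o₁ ℕ.* o₂)
  isOrder-∙ {z₁} {z₂} {o₁} {o₂} coprime ord₁@(o₁z₁≈ε , _) ord₂@(o₂z₂≈ε , _) = o₁o₂z≈ε , o₁o₂∣
    where
    o₁o₂z≈ε : natMul M (o₁ ℕ.* o₂) (z₁ ∙ z₂) ≈ ε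
    o₁o₂z≈ε = trans (natMul-∙ (o₁ ℕ.* o₂) z₁ z₂)
      (trans (∙-cong (natMul-multiple≈ε {o₁} z₁ o₁z₁≈ε (m∣m*n o₂))
                     (natMul-multiple≈ε {o₂} z₂ o₂z₂≈ε (n∣m*n o₁)))
        (identityˡ ε))
    o₁o₂∣ : ∀ j → natMul M j (z₁ ∙ z₂) ≈ ε → o₁ ℕ.* o₂ ∣ j
    o₁o₂∣ j jz≈ε = coprime⇒*∣ coprime
      (isOrder-∙-∣ coprime ord₁ o₂z₂≈ε j jz≈ε)
      (isOrder-∙-∣ (Coprime.sym coprime) ord₂ o₁z₁≈ε j (trans (natMul-cong j (comm z₂ z₁)) jz≈ε))

  module _ {n x} (x-order : HasOrder M x n) (bounded : ∀ z → Σ ℕ λ k → HasOrder M z k × k ℕ.≤ n) where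

    coprime-orders-≤ : ∀ {z₁ z₂ o₁ o₂} → Coprime o₁ o₂ → IsOrder z₁ o₁ → IsOrder z₂ o₂ →
                       o₁ ℕ.* o₂ ℕ.≤ n
    coprime-orders-≤ {z₁} {z₂} coprime ord₁ ord₂ with bounded (z₁ ∙ z₂)
    ... | k , (k>0 , kz≈ε , _) , k≤n =
      ℕP.≤-trans (∣⇒≤ {{ℕ.>-nonZero k>0}} (proj₂ (isOrder-∙ coprime ord₁ ord₂) k kz≈ε)) k≤n

    -- Strong induction on d: with g = gcd n d and n = g n₁, either gcd n₁ d = 1, and then
    -- (g x)(q y) has order n₁ d ≤ n = n₁ g, forcing d = g; or a proper factor d′ of d
    -- divides n by induction and d = d′ gcd(n₁, d) divides g n₁ = n.
    divides-maxOrder : ∀ {y m} → HasOrder M y m → ∀ d → d ∣ m → d ∣ n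
    divides-maxOrder {y} {m} y-order@(m>0 , _) = <-rec (λ d → d ∣ m → d ∣ n) step
      where
      instance
        n≢0 : NonZero n
        n≢0 = ℕ.>-nonZero (proj₁ x-order)
        m≢0 : NonZero m
        m≢0 = ℕ.>-nonZero m>0

      step : ∀ d → (∀ {d′} → d′ ℕ.< d → d′ ∣ m → d′ ∣ n) → d ∣ m → d ∣ n
      step d rec d∣m = by-gcd (gcd n₁ d ℕ.≟ 1)
        where
        instance
          d≢0 : NonZero d
          d≢0 = ℕ.≢-nonZero λ d≡0 → ℕ.≢-nonZero⁻¹ m (0∣⇒≡0 (≡.subst (_∣ m) d≡0 d∣m))
        g = gcd n d
        g∣n = gcd[m,n]∣m n d
        n₁ = quotient g∣n

        by-gcd : Dec (gcd n₁ d ≡ 1) → d ∣ n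
        by-gcd (yes coprime) = ≡.subst (_∣ n) (≡.sym d≡g) g∣n
          where
          instance
            g≢0 : NonZero g
            g≢0 = ℕ.≢-nonZero λ g≡0 → ℕ.≢-nonZero⁻¹ d (gcd[m,n]≡0⇒n≡0 n g≡0)
            n₁≢0 = quotient≢0 g∣n
            q≢0 = quotient≢0 d∣m
          gx-order : IsOrder (natMul M g x) n₁
          gx-order = isOrder-multiple g (≡.subst (IsOrder x) (m∣n⇒n≡m*quotient g∣n) (hasOrder⇒isOrder x-order))
          qy-order : IsOrder (natMul M (quotient d∣m) y) d
          qy-order = isOrder-multiple (quotient d∣m)
                       (≡.subst (IsOrder y) (m∣n⇒n≡quotient*m d∣m) (hasOrder⇒isOrder y-order))
          d≤g : d ℕ.≤ g
          d≤g = ℕP.*-cancelˡ-≤ n₁ (≡.subst (n₁ ℕ.* d ℕ.≤_) (m∣n⇒n≡quotient*m g∣n)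
                  (coprime-orders-≤ (gcd≡1⇒coprime coprime) gx-order qy-order))
          d≡g : d ≡ g
          d≡g = ℕP.≤-antisym d≤g (∣⇒≤ (gcd[m,n]∣n n d))
        by-gcd (no h≢1) =
          ≡.subst₂ _∣_ (≡.sym (m∣n⇒n≡quotient*m h∣d)) (≡.sym (m∣n⇒n≡m*quotient g∣n)) (*-pres-∣ d′∣g h∣n₁)
          where
          h∣d = gcd[m,n]∣n n₁ d
          h∣n₁ = gcd[m,n]∣m n₁ d
          instance
            h>1 : NonTrivial (gcd n₁ d)
            h>1 = ℕ.n>1⇒nonTrivial
                    (ℕP.≤∧≢⇒< (ℕP.n≢0⇒n>0 (λ h≡0 → ℕ.≢-nonZero⁻¹ d (gcd[m,n]≡0⇒n≡0 n₁ h≡0))) (≢-sym h≢1))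
          d′∣d = quotient-∣ h∣d
          d′∣g = gcd-greatest (rec (quotient-< h∣d) (∣-trans d′∣d d∣m)) d′∣d

  maxOrder-annihilates : ∀ {n} → nIs M n → ∀ y → natMul M n y ≈ ε
  maxOrder-annihilates {n} ((x , x-order) , bounded) y with bounded y
  ... | m , y-order@(_ , my≈ε , _) , _ =
    natMul-multiple≈ε {m} y my≈ε (divides-maxOrder x-order bounded y-order m ∣-refl)

module ℤMorphisms {b ℓ} (N : RawMonoid b ℓ) = MonoidMorphisms (AbelianGroup.rawMonoid ℤ-group) N
module ℤₙMorphisms (n : ℕ) {b ℓ} (N : RawMonoid b ℓ) = MonoidMorphisms (AbelianGroup.rawMonoid (ℤ-mod n)) N

reduction-isMonoidHomomorphism : ∀ n → ℤMorphisms.IsMonoidHomomorphism (AbelianGroup.rawMonoid (ℤ-mod n)) (λ a → a)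
reduction-isMonoidHomomorphism n = record
  { isMagmaHomomorphism = record
    { isRelHomomorphism = record { cong = AbelianGroup.reflexive (ℤ-mod n) }
    ; homo = λ _ _ → AbelianGroup.refl (ℤ-mod n)
    }
  ; ε-homo = AbelianGroup.refl (ℤ-mod n)
  }

module IntMulHomomorphisms {c ℓ} (M : AbelianGroup c ℓ) where
  open AbelianGroup M
  open import Algebra.Properties.Group group using (ε⁻¹≈ε; ⁻¹-injective; x∙y⁻¹≈ε⇒x≈y; x≈y⇒x∙y⁻¹≈ε)
  open Multiples M
  open Orders M
  open import Relation.Binary.Reasoning.Setoid setoid

  ⁻¹≈ε⇒≈ε : ∀ {y} → y ⁻¹ ≈ ε → y ≈ ε
  ⁻¹≈ε⇒≈ε y⁻¹≈ε = ⁻¹-injective (trans y⁻¹≈ε (sym ε⁻¹≈ε))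

  intMul≈⇒intMul-≈ε : ∀ {a b} x → intMul M a x ≈ intMul M b x → intMul M (a ℤ.- b) x ≈ ε
  intMul≈⇒intMul-≈ε {a} {b} x ax≈bx = trans (intMul-minus a b x) (x≈y⇒x∙y⁻¹≈ε ax≈bx)

  intMul-isMonoidHomomorphism : ∀ x → ℤMorphisms.IsMonoidHomomorphism rawMonoid (λ a → intMul M a x)
  intMul-isMonoidHomomorphism x = record
    { isMagmaHomomorphism = record
      { isRelHomomorphism = record { cong = λ a≡b → reflexive (≡.cong (λ a → intMul M a x) a≡b) }
      ; homo = λ a b → intMul-+ a b x
      }
    ; ε-homo = refl
    }

  intMul-isMonoidMonomorphism : ∀ {x} → InfiniteOrder M x →
                                ℤMorphisms.IsMonoidMonomorphism rawMonoid (λ a → intMul M a x)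
  intMul-isMonoidMonomorphism {x} x-infinite = record
    { isMonoidHomomorphism = intMul-isMonoidHomomorphism x
    ; injective = λ {a} {b} ax≈bx → ℤP.i-j≡0⇒i≡j a b (kernel (a ℤ.- b) (intMul≈⇒intMul-≈ε {a} {b} x ax≈bx))
    }
    where
    kernel : ∀ k → intMul M k x ≈ ε → k ≡ 0ℤ
    kernel (+ zero)  _     = ≡.refl
    kernel (+ suc p) kx≈ε  = contradiction kx≈ε (x-infinite (suc p) (ℕ.s≤s ℕ.z≤n))
    kernel -[1+ p ]  kx≈ε  = contradiction (⁻¹≈ε⇒≈ε kx≈ε) (x-infinite (suc p) (ℕ.s≤s ℕ.z≤n))

  intMulₙ-isMonoidHomomorphism : ∀ {n x} → natMul M n x ≈ ε →
                                 ℤₙMorphisms.IsMonoidHomomorphism n rawMonoid (λ a → intMul M a x)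
  intMulₙ-isMonoidHomomorphism {n} {x} nx≈ε = record
    { isMagmaHomomorphism = record
      { isRelHomomorphism = record { cong = cong }
      ; homo = λ a b → intMul-+ a b x
      }
    ; ε-homo = refl
    }
    where
    cong : ∀ {a b} → a ≡[mod n ] b → intMul M a x ≈ intMul M b x
    cong {a} {b} (q , a-b≡qn) = x∙y⁻¹≈ε⇒x≈y _ _ (begin
      intMul M a x ∙ intMul M b x ⁻¹  ≈⟨ intMul-minus a b x ⟨
      intMul M (a ℤ.- b) x            ≡⟨ ≡.cong (λ k → intMul M k x) a-b≡qn ⟩
      intMul M (q ℤ.* + n) x          ≈⟨ intMul-multiple≈ε q nx≈ε ⟩
      ε                               ∎)

  intMulₙ-isMonoidMonomorphism : ∀ {n x} → HasOrder M x n →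
                                 ℤₙMorphisms.IsMonoidMonomorphism n rawMonoid (λ a → intMul M a x)
  intMulₙ-isMonoidMonomorphism {n} {x} x-order = record
    { isMonoidHomomorphism = intMulₙ-isMonoidHomomorphism nx≈ε
    ; injective = λ {a} {b} ax≈bx →
        let q , a-b≡qn = kernel (a ℤ.- b) (intMul≈⇒intMul-≈ε {a} {b} x ax≈bx) in q , a-b≡qn
    }
    where
    open Σ (hasOrder⇒isOrder x-order) renaming (proj₁ to nx≈ε; proj₂ to n∣)
    kernel : ∀ k → intMul M k x ≈ ε → Σ ℤ λ q → k ≡ q ℤ.* + n
    kernel (+ p) px≈ε with n∣ p px≈ε
    ... | divides q p≡qn = + q , ≡.trans (≡.cong +_ p≡qn) (ℤP.pos-* q n)
    kernel -[1+ p ] kx≈ε with n∣ (suc p) (⁻¹≈ε⇒≈ε kx≈ε)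
    ... | divides q p≡qn = ℤ.- + q , ≡.trans (≡.cong (λ i → ℤ.- + i) p≡qn)
                                      (≡.trans (≡.cong ℤ.-_ (ℤP.pos-* q n)) (ℤP.neg-distribˡ-* (+ q) (+ n)))

neg-isMonoidHomomorphism : ℤMorphisms.IsMonoidHomomorphism (AbelianGroup.rawMonoid ℤ-group) (λ i → ℤ.- i)
neg-isMonoidHomomorphism = record
  { isMagmaHomomorphism = record
    { isRelHomomorphism = record { cong = ≡.cong (λ i → ℤ.- i) }
    ; homo = ℤP.neg-distrib-+
    }
  ; ε-homo = ≡.refl
  }

module Dichotomy where
  open VertexSums ℤ-group
  open FlowMaps ℤ-group ℤ-group using (sumAt-homo)
  open +-*-Solver

  δ : ∀ {n} → Fin n → Fin n → ℤ
  δ a v = keepIf (does (a Fin.≟ v)) (+ 1)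

  -- z carries one unit from a to b: it becomes balanced once an edge b → a of value 1 is added.
  UnitFlow : ∀ {n k} → (t h : Fin k → Fin n) → Fin n → Fin n → (Fin k → ℤ) → Set
  UnitFlow t h a b z = ∀ v → sumAt t z v ℤ.+ δ b v ≡ sumAt h z v ℤ.+ δ a v

  record Separates {n k} (t h : Fin k → Fin n) (S : Fin n → Bool) (a b : Fin n) : Set where
    field
      closed  : ∀ e → S (t e) ≡ S (h e)
      inside  : S a ≡ true
      outside : S b ≡ false

  data Dichotomy {n k} (t h : Fin k → Fin n) (a b : Fin n) : Set where
    route : ∀ z → UnitFlow t h a b z → Dichotomy t h a b
    cut   : ∀ S → Separates t h S a b → Dichotomy t h a b

  separates-not : ∀ {n k} {t h : Fin k → Fin n} {S a b} → Separates t h S a b → Separates t h (not ∘ S) b a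
  separates-not sep = record
    { closed  = λ e → ≡.cong not (closed e)
    ; inside  = ≡.cong not outside
    ; outside = ≡.cong not inside
    }
    where open Separates sep

  dichotomy-sym : ∀ {n k} {t h : Fin k → Fin n} {a b} → Dichotomy t h b a → Dichotomy t h a b
  dichotomy-sym {t = t} {h} {a} {b} (route z z-route) = route (λ e → ℤ.- z e) λ v → begin
      sumAt t (λ e → ℤ.- z e) v ℤ.+ δ b v     ≡⟨ ≡.cong (ℤ._+ δ b v) (sumAt-homo neg-isMonoidHomomorphism t z v) ⟩
      ℤ.- sumAt t z v ℤ.+ δ b v               ≡⟨ negate (sumAt t z v) (sumAt h z v) (δ a v) (δ b v) (z-route v) ⟩
      ℤ.- sumAt h z v ℤ.+ δ a v               ≡⟨ ≡.cong (ℤ._+ δ a v) (sumAt-homo neg-isMonoidHomomorphism h z v) ⟨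
      sumAt h (λ e → ℤ.- z e) v ℤ.+ δ a v     ∎
    where
    open ≡.≡-Reasoning
    negate : ∀ o i da db → o ℤ.+ da ≡ i ℤ.+ db → ℤ.- o ℤ.+ db ≡ ℤ.- i ℤ.+ da
    negate o i da db eq =
      ≡.trans (lhs o da db) (≡.trans (≡.cong (λ x → ℤ.- x ℤ.+ (da ℤ.+ db)) eq) (rhs i da db))
      where
      lhs : ∀ o da db → ℤ.- o ℤ.+ db ≡ ℤ.- (o ℤ.+ da) ℤ.+ (da ℤ.+ db)
      lhs = solve 3 (λ o da db → :- o :+ db := :- (o :+ da) :+ (da :+ db)) ≡.refl
      rhs : ∀ i da db → ℤ.- (i ℤ.+ db) ℤ.+ (da ℤ.+ db) ≡ ℤ.- i ℤ.+ da
      rhs = solve 3 (λ i da db → :- (i :+ db) :+ (da :+ db) := :- i :+ da) ≡.refl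
  dichotomy-sym (cut S sep) = cut (not ∘ S) (separates-not sep)

  module _ {n k} {t h : Fin (suc k) → Fin n} where
    private
      t′ = t ∘ Fin.suc
      h′ = h ∘ Fin.suc
      u = t Fin.zero
      w = h Fin.zero

    unitFlow-0∷ : ∀ {a b z} → UnitFlow t′ h′ a b z → UnitFlow t h a b (0ℤ ∷ z)
    unitFlow-0∷ {a} {b} {z} z-route v =
      ≡.trans (≡.cong (ℤ._+ δ b v) (sumAt-drop t {0ℤ ∷ z} ≡.refl v))
        (≡.trans (z-route v) (≡.cong (ℤ._+ δ a v) (≡.sym (sumAt-drop h {0ℤ ∷ z} ≡.refl v))))

    separates-∷ : ∀ {S a b} → Separates t′ h′ S a b → S u ≡ S w → Separates t h S a b
    separates-∷ sep same = record
      { closed = λ { Fin.zero → same ; (Fin.suc e) → closed e } ; inside = inside ; outside = outside }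
      where open Separates sep

    -- The first edge u → w leaves S: route a ⇝ u, cross the edge, route w ⇝ b; or one of
    -- these two routes is blocked by a cut, which combines with S into a cut between a and b.
    crossing : (∀ a b → Dichotomy t′ h′ a b) → ∀ {S a b} → Separates t′ h′ S a b →
               S u ≡ true → S w ≡ false → Dichotomy t h a b
    crossing dichotomy′ {S} {a} {b} sep u∈S w∉S with dichotomy′ a u | dichotomy′ w b
    ... | route z₁ r₁ | route z₂ r₂ = route (+ 1 ∷ λ e → z₁ e ℤ.+ z₂ e) λ v → begin
      δ u v ℤ.+ sumAt t′ (λ e → z₁ e ℤ.+ z₂ e) v ℤ.+ δ b v
        ≡⟨ ≡.cong (λ x → δ u v ℤ.+ x ℤ.+ δ b v) (sumAt-∙ t′ z₁ z₂ v) ⟩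
      δ u v ℤ.+ (sumAt t′ z₁ v ℤ.+ sumAt t′ z₂ v) ℤ.+ δ b v
        ≡⟨ join (δ u v) (δ w v) (δ a v) (δ b v) (sumAt t′ z₁ v) (sumAt t′ z₂ v)
                (sumAt h′ z₁ v) (sumAt h′ z₂ v) (r₁ v) (r₂ v) ⟩
      δ w v ℤ.+ (sumAt h′ z₁ v ℤ.+ sumAt h′ z₂ v) ℤ.+ δ a v
        ≡⟨ ≡.cong (λ x → δ w v ℤ.+ x ℤ.+ δ a v) (sumAt-∙ h′ z₁ z₂ v) ⟨
      δ w v ℤ.+ sumAt h′ (λ e → z₁ e ℤ.+ z₂ e) v ℤ.+ δ a v ∎
      where
      open ≡.≡-Reasoning
      join : ∀ du dw da db o₁ o₂ i₁ i₂ → o₁ ℤ.+ du ≡ i₁ ℤ.+ da → o₂ ℤ.+ db ≡ i₂ ℤ.+ dw →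
             du ℤ.+ (o₁ ℤ.+ o₂) ℤ.+ db ≡ dw ℤ.+ (i₁ ℤ.+ i₂) ℤ.+ da
      join du dw da db o₁ o₂ i₁ i₂ p₁ p₂ = ≡.trans
        (solve 4 (λ du db o₁ o₂ → du :+ (o₁ :+ o₂) :+ db := (o₁ :+ du) :+ (o₂ :+ db)) ≡.refl du db o₁ o₂)
        (≡.trans (≡.cong₂ ℤ._+_ p₁ p₂)
          (solve 4 (λ dw da i₁ i₂ → (i₁ :+ da) :+ (i₂ :+ dw) := dw :+ (i₁ :+ i₂) :+ da) ≡.refl dw da i₁ i₂))
    ... | cut S₁ sep₁ | _ = cut (λ v → S₁ v ∧ S v) record
      { closed  = λ { Fin.zero → closed₀ ; (Fin.suc e) → ≡.cong₂ _∧_ (Separates.closed sep₁ e) (closed e) }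
      ; inside  = ≡.cong₂ _∧_ (Separates.inside sep₁) inside
      ; outside = ≡.trans (≡.cong (S₁ b ∧_) outside) (∧-zeroʳ (S₁ b))
      }
      where
      open Separates sep
      closed₀ : S₁ u ∧ S u ≡ S₁ w ∧ S w
      closed₀ rewrite Separates.outside sep₁ | w∉S | ∧-zeroʳ (S₁ w) = ≡.refl
    ... | route _ _ | cut S₂ sep₂ = cut (λ v → S v ∨ S₂ v) record
      { closed  = λ { Fin.zero → closed₀ ; (Fin.suc e) → ≡.cong₂ _∨_ (closed e) (Separates.closed sep₂ e) }
      ; inside  = ≡.cong (_∨ S₂ a) inside
      ; outside = ≡.cong₂ _∨_ outside (Separates.outside sep₂)
      }
      where
      open Separates sep
      closed₀ : S u ∨ S₂ u ≡ S w ∨ S₂ w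
      closed₀ rewrite u∈S | w∉S | Separates.inside sep₂ = ≡.refl

  dichotomy : ∀ {n} k (t h : Fin k → Fin n) a b → Dichotomy t h a b
  dichotomy zero t h a b with a Fin.≟ b
  ... | yes ≡.refl = route (λ ()) (λ _ → ≡.refl)
  ... | no a≢b = cut (λ v → does (a Fin.≟ v))
    record { closed = λ () ; inside = dec-true (a Fin.≟ a) ≡.refl ; outside = dec-false (a Fin.≟ b) a≢b }
  dichotomy (suc k) t h a b with dichotomy k (t ∘ Fin.suc) (h ∘ Fin.suc) a b
  ... | route z z-route = route (0ℤ ∷ z) (unitFlow-0∷ {t = t} {h} {a} {b} z-route)
  ... | cut S sep with S (t Fin.zero) in u-side | S (h Fin.zero) in w-side
  ...   | true  | true  = cut S (separates-∷ sep (≡.trans u-side (≡.sym w-side)))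
  ...   | false | false = cut S (separates-∷ sep (≡.trans u-side (≡.sym w-side)))
  ...   | true  | false = crossing (dichotomy k _ _) sep u-side w-side
  ...   | false | true  = dichotomy-sym
    (crossing (dichotomy k _ _) (separates-not sep) (≡.cong not u-side) (≡.cong not w-side))

module Decomposition {c ℓ} (M : AbelianGroup c ℓ) where
  open AbelianGroup M
  open import Algebra.Properties.AbelianGroup M using (xyx⁻¹≈y; ⁻¹-∙-comm)
  open import Algebra.Properties.Group group using (ε⁻¹≈ε)
  open import Algebra.Properties.CommutativeMonoid.Sum commutativeMonoid using (sum-syntax; sum-replicate-zero)
  open MonoidMorphisms rawMonoid rawMonoid using (IsMonoidHomomorphism)
  open VertexSums M
  open FlowMaps M M using (balanced-map)
  open FlowMaps ℤ-group M using () renaming (balanced-map to balanced-mapℤ)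
  open IntMulHomomorphisms M using (intMul-isMonoidHomomorphism)
  open Dichotomy
  private module ℤΣ = VertexSums ℤ-group

  ⁻¹-isMonoidHomomorphism : IsMonoidHomomorphism _⁻¹
  ⁻¹-isMonoidHomomorphism = record
    { isMagmaHomomorphism = record
      { isRelHomomorphism = record { cong = ⁻¹-cong }
      ; homo = λ x y → sym (⁻¹-∙-comm x y)
      }
    ; ε-homo = ε⁻¹≈ε
    }

  record ℤ-Decomposition {n k} (t h : Fin k → Fin n) (φ : Fin k → Carrier) : Set (c Level.⊔ ℓ) where
    field
      size           : ℕ
      flows          : Fin size → Fin k → ℤ
      coefficients   : Fin size → Carrier
      flows-balanced : ∀ i → ℤΣ.Balanced t h (flows i)
      expansion      : ∀ e → φ e ≈ ∑[ i < size ] intMul M (flows i e) (coefficients i)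

  module _ {n k} {t h : Fin k → Fin n} where

    decomposition-cong : ∀ {φ ψ} → (∀ e → φ e ≈ ψ e) → ℤ-Decomposition t h ψ → ℤ-Decomposition t h φ
    decomposition-cong φ≈ψ D = record
      { size = size ; flows = flows ; coefficients = coefficients ; flows-balanced = flows-balanced
      ; expansion = λ e → trans (φ≈ψ e) (expansion e)
      }
      where open ℤ-Decomposition D

    decomposition-add : ∀ {z ψ} → ℤΣ.Balanced t h z → ∀ x → ℤ-Decomposition t h ψ →
                        ℤ-Decomposition t h (λ e → intMul M (z e) x ∙ ψ e)
    decomposition-add {z} z-balanced x D = record
      { size           = suc size
      ; flows          = z ∷ flows
      ; coefficients   = x ∷ coefficients
      ; flows-balanced = λ { Fin.zero → z-balanced ; (Fin.suc i) → flows-balanced i }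
      ; expansion      = λ e → ∙-congˡ (expansion e)
      }
      where open ℤ-Decomposition D

  decomposition-ε∷ : ∀ {n k} {t h : Fin (suc k) → Fin n} {φ} → φ Fin.zero ≈ ε →
                     ℤ-Decomposition (t ∘ Fin.suc) (h ∘ Fin.suc) (φ ∘ Fin.suc) → ℤ-Decomposition t h φ
  decomposition-ε∷ {t = t} {h} φ₀≈ε D = record
    { size           = size
    ; flows          = λ i → 0ℤ ∷ flows i
    ; coefficients   = coefficients
    ; flows-balanced = λ i → ℤΣ.balanced-ε∷ (flows-balanced i)
    ; expansion      = λ { Fin.zero → trans φ₀≈ε (sym (sum-replicate-zero size)) ; (Fin.suc e) → expansion e }
    }
    where open ℤ-Decomposition D

  decompose : ∀ {n} k (t h : Fin k → Fin n) φ → Balanced t h φ → ℤ-Decomposition t h φ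
  decompose zero t h φ _ = record
    { size = 0 ; flows = λ () ; coefficients = λ () ; flows-balanced = λ () ; expansion = λ () }
  decompose (suc k) t h φ φ-balanced with dichotomy k (t ∘ Fin.suc) (h ∘ Fin.suc) (h Fin.zero) (t Fin.zero)
  ... | cut S sep = decomposition-ε∷ φ₀≈ε (decompose k _ _ (φ ∘ Fin.suc) (balanced-drop φ₀≈ε φ-balanced))
    where
    open Separates sep
    φ₀≈ε : φ Fin.zero ≈ ε
    φ₀≈ε = balanced-bridge φ-balanced {S} closed outside inside
  ... | route z z-route = decomposition-cong split (decomposition-add cycle-balanced (φ Fin.zero)
          (decomposition-ε∷ ψ₀≈ε (decompose k _ _ (ψ ∘ Fin.suc) (balanced-drop ψ₀≈ε ψ-balanced))))
    where
    cycle : Fin (suc k) → ℤ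
    cycle = + 1 ∷ z
    cycle-balanced : ℤΣ.Balanced t h cycle
    cycle-balanced = ℤΣ.balanced λ v →
      ≡.trans (ℤP.+-comm (δ (t Fin.zero) v) _) (≡.trans (z-route v) (ℤP.+-comm _ (δ (h Fin.zero) v)))
    ψ : Fin (suc k) → Carrier
    ψ e = φ e ∙ intMul M (cycle e) (φ Fin.zero) ⁻¹
    ψ-balanced : Balanced t h ψ
    ψ-balanced = balanced-∙ φ-balanced (balanced-map ⁻¹-isMonoidHomomorphism
                   (balanced-mapℤ (intMul-isMonoidHomomorphism (φ Fin.zero)) cycle-balanced))
    ψ₀≈ε : ψ Fin.zero ≈ ε
    ψ₀≈ε = trans (∙-congˡ (⁻¹-cong (identityʳ _))) (inverseʳ _)
    split : ∀ e → φ e ≈ intMul M (cycle e) (φ Fin.zero) ∙ ψ e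
    split e = sym (trans (sym (assoc _ _ _)) (xyx⁻¹≈y _ _))

  flowContinuous-fromℤ : ∀ {G H f} →
                         (∀ z x → IsFlow ℤ-group H z → IsFlow M G (λ e → intMul M (z (f e)) x)) →
                         FlowContinuous M G H f
  flowContinuous-fromℤ {G} {H} {f} pull φ φ-flow = Equivalence.from (isFlow⇔balanced G _)
    (balanced-cong (λ e → sym (expansion (f e)))
      (balanced-sum λ i → Equivalence.to (isFlow⇔balanced G _)
        (pull (flows i) (coefficients i) (Equivalence.from (ℤΣ.isFlow⇔balanced H _) (flows-balanced i)))))
    where
    open ℤ-Decomposition (decompose (nE H) (tail H) (head H) φ (Equivalence.to (isFlow⇔balanced H φ) φ-flow))

lemma2p3 : ∀ {c ℓ : Level} (M : AbelianGroup c ℓ) → FinitelyGenerated M →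
    (G H : Digraph) (f : E G → E H) →
      (nIsInfinite M → (FlowContinuous M G H f ⇔ FlowContinuous ℤ-group G H f))
      × (∀ (n : ℕ) → nIs M n → (FlowContinuous M G H f ⇔ FlowContinuous (ℤ-mod n) G H f))
lemma2p3 M _ G H f = infinite , finite
  where
  open IntMulHomomorphisms M
  open Orders M using (maxOrder-annihilates)
  open Decomposition M using (flowContinuous-fromℤ)
  module ℤ⇒M = FlowMaps ℤ-group M
  module ℤₙ⇒M n = FlowMaps (ℤ-mod n) M

  infinite : nIsInfinite M → (FlowContinuous M G H f ⇔ FlowContinuous ℤ-group G H f)
  infinite (x , x-infinite) = mk⇔
    (ℤ⇒M.flowContinuous-reflect (intMul-isMonoidMonomorphism x-infinite) {G} {H} {f})
    (λ ℤ-continuous → flowContinuous-fromℤ {G} {H} {f} λ z y z-flow →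
      ℤ⇒M.isFlow-map (intMul-isMonoidHomomorphism y) {G} (ℤ-continuous z z-flow))

  finite : ∀ n → nIs M n → (FlowContinuous M G H f ⇔ FlowContinuous (ℤ-mod n) G H f)
  finite n maximal@((x , x-order) , _) = mk⇔
    (ℤₙ⇒M.flowContinuous-reflect n (intMulₙ-isMonoidMonomorphism x-order) {G} {H} {f})
    (λ ℤₙ-continuous → flowContinuous-fromℤ {G} {H} {f} λ z y z-flow →
      ℤₙ⇒M.isFlow-map n (intMulₙ-isMonoidHomomorphism (maxOrder-annihilates maximal y)) {G}
        (ℤₙ-continuous z (FlowMaps.isFlow-map ℤ-group (ℤ-mod n) (reduction-isMonoidHomomorphism n) {H} z-flow)))
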